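{- The class $\mathcal{TBP}_2$ of all finite paving TBRSCs of dimension at most $2$ is not finitely based; that is, there is no $m\ge1$ such that every simplicial complex not in $\mathcal{TBP}_2$ admits a restriction not in $\mathcal{TBP}_2$ with at most $m$ vertices.
   Context: A simplicial complex is a pair $(V,H)$ with $V$ finite nonempty, $H\subseteq 2^V$ containing all singletons and closed under subsets; its dimension $e$ is $\max\{|X|:X\in H\}-1$, and it is paving if $P_{\le e}(V)\subseteq H$, where $P_{\le k}(V)$ is the set of subsets of $V$ with at most $k$ elements. The restriction of $(V,H)$ to a nonempty $W\subseteq V$ is $(W,H\cap 2^W)$. A flat is a set $F\subseteq V$ with $X\cup\{p\}\in H$ for all $X\in H$, $X\subseteq F$, $p\in V\setminus F$. A complex is boolean representable (BRSC) if it admits a boolean matrix representation; equivalently every face $\{x_1,\dots,x_k\}$ admits a chain of flats $F_0\subset\cdots\subset F_k$ with $x_i\in F_i\setminus F_{i-1}$. The $k$-truncation of $(V,H)$ is $(V,H\cap P_{\le k}(V))$; a TBRSC is a complex equal to the $k$-truncation of some BRSC for some $k\ge1$. -}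

module Defs where

open import Data.Nat using (ℕ; zero; suc; _≤_; _∸_)
open import Data.Fin using (Fin; inject₁) renaming (suc to fsuc)
open import Data.Fin.Subset public
  using (Subset; _∈_; _∉_; _⊆_; _⊂_; _∪_; _∩_; ⁅_⁆; ∣_∣; Nonempty)
open import Data.Product using (Σ; _×_; _,_)
open import Relation.Binary.PropositionalEquality using (_≡_)
open import Relation.Nullary using (¬_)

-- A (candidate) complex whose vertex set V is a finite subset of Fin n
-- (every finite set is in bijection with such a V); H is the set of faces.
record Pre (n : ℕ) : Set₁ where
  constructor mkPre
  field
    V : Subset n
    H : Subset n → Set
open Pre public

record IsSC {n : ℕ} (K : Pre n) : Set where
  field
    V-nonempty : Nonempty (V K)
    faces⊆V    : ∀ X → H K X → X ⊆ V K
    singletons : ∀ x → x ∈ V K → H K ⁅ x ⁆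
    down-closed : ∀ X Y → H K X → Y ⊆ X → H K Y

-- d = max{|X| : X ∈ H}  (so the dimension is e = d - 1)
IsMaxFaceSize : {n : ℕ} → Pre n → ℕ → Set
IsMaxFaceSize K d =
  Σ (Subset _) (λ X → H K X × ∣ X ∣ ≡ d) × (∀ X → H K X → ∣ X ∣ ≤ d)

Paving : {n : ℕ} → Pre n → Set
Paving K = ∀ d → IsMaxFaceSize K d →
  ∀ X → X ⊆ V K → ∣ X ∣ ≤ d ∸ 1 → H K X

DimAtMost2 : {n : ℕ} → Pre n → Set
DimAtMost2 K = ∀ X → H K X → ∣ X ∣ ≤ 3

Flat : {n : ℕ} → Pre n → Subset n → Set
Flat K F = F ⊆ V K ×
  (∀ X p → H K X → X ⊆ F → p ∈ V K → p ∉ F → H K (X ∪ ⁅ p ⁆))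

-- the face X = {x_1,…,x_k} admits a chain of flats F_0 ⊂ ⋯ ⊂ F_k
-- with x_i ∈ F_i ∖ F_{i-1}  (indices shifted to start at 0 here)
HasFlatChain : {n : ℕ} → Pre n → Subset n → Set
HasFlatChain {n} K X =
  Σ ℕ λ k → Σ (Fin k → Fin n) λ x → Σ (Fin (suc k) → Subset n) λ F →
    (∀ y → y ∈ X → Σ (Fin k) λ i → x i ≡ y) ×
    (∀ i → x i ∈ X) ×
    (∀ j → Flat K (F j)) ×
    (∀ i → F (inject₁ i) ⊂ F (fsuc i)) ×
    (∀ i → x i ∈ F (fsuc i) × x i ∉ F (inject₁ i))

-- boolean representable simplicial complex (flat-chain characterization)
BRSC : {n : ℕ} → Pre n → Set
BRSC K = IsSC K × (∀ X → H K X → HasFlatChain K X)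

IsTruncation : {n : ℕ} → Pre n → Pre n → ℕ → Set
IsTruncation K L k = V K ≡ V L ×
  (∀ X → (H K X → H L X × ∣ X ∣ ≤ k) × (H L X × ∣ X ∣ ≤ k → H K X))

TBRSC : {n : ℕ} → Pre n → Set₁
TBRSC {n} K = Σ (Pre n) λ L → Σ ℕ λ k → 1 ≤ k × BRSC L × IsTruncation K L k

TBP₂ : {n : ℕ} → Pre n → Set₁
TBP₂ K = TBRSC K × Paving K × DimAtMost2 K

restrict : {n : ℕ} → Pre n → Subset n → Pre n
restrict K W = mkPre W (λ X → H K X × X ⊆ W)

-- Fix m and let q = m + 8. On the vertices 0, …, q+1 let K be the paving complex of dimension 2 whose
-- non-faces among 3-sets are the consecutive triples {a, a+1, a+2} and the two long triples {0, q, q+1},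
-- {1, q, q+1}. If K were the k-truncation of a BRSC L, then k ≥ 3 and every flat of L would be closed
-- under these triples: two points of a flat and a third point completing a triple would form a face of L
-- of size 3, hence of K. Consecutive triples propagate membership along the path and the long triples
-- join 0 and 1 to q, so a flat containing two of 0, 1, q+1 contains the third, and the face {0, 1, q+1}
-- has no chain of flats. On the other hand a set W of at most m vertices misses some g with 2 ≤ g ≤ q.
-- The subsets of W closed under the triples form a closure system, and the complex of sets listed by its
-- chains is a BRSC whose 3-truncation is K restricted to W: every triple of W that is a face is separated
-- by a closed set, either a pair lying in no forbidden triple or, for {0, 1, z} with z ≥ q, the prefix
-- W ∩ [0, g), which no forbidden triple straddles.

module Submission where

open import Defs

open import Data.Nat using (ℕ; zero; suc; _+_; _∸_; _≤_; _<_; _≤?_; _<?_; _≤′_; ≤′-refl; ≤′-step; z≤n; s≤s)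
open import Data.Nat.Properties
open import Data.Fin as Fin using (Fin; toℕ; inject₁; fromℕ; fromℕ<) renaming (zero to fzero; suc to fsuc)
import Data.Fin.Properties as Finₚ
open import Data.Fin.Properties using (toℕ-injective; toℕ<n; toℕ-fromℕ; toℕ-fromℕ<; toℕ-inject₁)
open import Data.Fin.Subset renaming (⊥ to ∅)
open import Data.Fin.Subset.Properties
open import Data.Vec using ([]; _∷_; here; there)
open import Data.List using (List; []; _∷_; map; length; lookup; filter; _++_; [_])
open import Data.List.Properties using (length-map)
open import Data.List.Membership.Propositional using () renaming (_∈_ to _∈ˡ_)
open import Data.List.Membership.Propositional.Properties
  using (∈-map⁺; ∈-map⁻; ∈-++⁺ˡ; ∈-++⁺ʳ; ∈-++⁻; ∈-filter⁺; ∈-filter⁻; ∈-lookup)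
open import Data.List.Relation.Unary.Any using (here; there; index)
open import Data.List.Relation.Unary.Any.Properties using (lookup-index)
open import Data.List.Relation.Unary.Linked as Linked using (Linked; []; [-]; _∷_)
open import Data.List.Relation.Unary.Linked.Properties using (map⁺)
open import Data.List.Relation.Binary.Permutation.Propositional
  using (_↭_; ↭-refl; ↭-prep; ↭-swap; ↭-sym; ↭-trans)
open import Data.List.Relation.Binary.Permutation.Propositional.Properties using (∈-resp-↭)
open import Data.Product using (Σ; ∃; _×_; _,_; proj₁; proj₂; uncurry)
open import Data.Sum using (_⊎_; inj₁; inj₂)
open import Data.Empty using (⊥; ⊥-elim)
open import Function using (_∘_)
open import Relation.Binary.Definitions using (tri<; tri≈; tri>)
open import Relation.Binary.PropositionalEquality using (_≡_; _≢_; refl; sym; trans; cong; cong₂; subst)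
open import Relation.Nullary using (¬_; yes; no; ¬?; _×-dec_)

enum : ∀ {n} → Subset n → List (Fin n)
enum []            = []
enum (inside ∷ p)  = fzero ∷ map fsuc (enum p)
enum (outside ∷ p) = map fsuc (enum p)

module _ {n : ℕ} where

  Enumerates : List (Fin n) → Subset n → Set
  Enumerates xs X = (∀ {y} → y ∈ X → y ∈ˡ xs) × (∀ {y} → y ∈ˡ xs → y ∈ X)

  Enumerates-↭ : ∀ {xs ys X} → xs ↭ ys → Enumerates xs X → Enumerates ys X
  Enumerates-↭ xs↭ys (to , from) = ∈-resp-↭ xs↭ys ∘ to , from ∘ ∈-resp-↭ (↭-sym xs↭ys)

  Enumerates-⁅⁆ : ∀ x → Enumerates [ x ] ⁅ x ⁆
  Enumerates-⁅⁆ x = here ∘ x∈⁅y⁆⇒x≡y x , λ { (here refl) → x∈⁅x⁆ x }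

  Enumerates-++ : ∀ {xs ys X Y} → Enumerates xs X → Enumerates ys Y → Enumerates (xs ++ ys) (X ∪ Y)
  Enumerates-++ {xs} {X = X} {Y} (toX , fromX) (toY , fromY) = to , from
    where
      to : ∀ {y} → y ∈ X ∪ Y → y ∈ˡ xs ++ _
      to y∈ with x∈p∪q⁻ X Y y∈
      ... | inj₁ y∈X = ∈-++⁺ˡ (toX y∈X)
      ... | inj₂ y∈Y = ∈-++⁺ʳ xs (toY y∈Y)
      from : ∀ {y} → y ∈ˡ xs ++ _ → y ∈ X ∪ Y
      from y∈ with ∈-++⁻ xs y∈
      ... | inj₁ y∈xs = x∈p∪q⁺ (inj₁ (fromX y∈xs))
      ... | inj₂ y∈ys = x∈p∪q⁺ (inj₂ (fromY y∈ys))

∈-enum⁺ : ∀ {n} (p : Subset n) {x} → x ∈ p → x ∈ˡ enum p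
∈-enum⁺ (inside ∷ p)  here        = here refl
∈-enum⁺ (inside ∷ p)  (there x∈p) = there (∈-map⁺ fsuc (∈-enum⁺ p x∈p))
∈-enum⁺ (outside ∷ p) (there x∈p) = ∈-map⁺ fsuc (∈-enum⁺ p x∈p)

∈-enum⁻ : ∀ {n} (p : Subset n) {x} → x ∈ˡ enum p → x ∈ p
∈-enum⁻ (inside ∷ p) (here refl) = here
∈-enum⁻ (inside ∷ p) (there x∈) with ∈-map⁻ fsuc x∈
... | _ , y∈ , refl = there (∈-enum⁻ p y∈)
∈-enum⁻ (outside ∷ p) x∈ with ∈-map⁻ fsuc x∈
... | _ , y∈ , refl = there (∈-enum⁻ p y∈)

enum-enumerates : ∀ {n} (p : Subset n) → Enumerates (enum p) p
enum-enumerates p = ∈-enum⁺ p , ∈-enum⁻ p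

length-enum : ∀ {n} (p : Subset n) → length (enum p) ≡ ∣ p ∣
length-enum []            = refl
length-enum (inside ∷ p)  = cong suc (trans (length-map fsuc (enum p)) (length-enum p))
length-enum (outside ∷ p) = trans (length-map fsuc (enum p)) (length-enum p)

enum-sorted : ∀ {n} (p : Subset n) → Linked Fin._<_ (enum p)
enum-sorted []            = []
enum-sorted (outside ∷ p) = map⁺ (Linked.map s≤s (enum-sorted p))
enum-sorted (inside ∷ p) with enum p | enum-sorted p
... | []     | _      = [-]
... | _ ∷ _  | sorted = s≤s z≤n ∷ map⁺ (Linked.map s≤s sorted)

∣p∪q∣≤∣p∣+∣q∣ : ∀ {n} (p q : Subset n) → ∣ p ∪ q ∣ ≤ ∣ p ∣ + ∣ q ∣
∣p∪q∣≤∣p∣+∣q∣ []            []            = z≤n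
∣p∪q∣≤∣p∣+∣q∣ (inside ∷ p)  (inside ∷ q)  = s≤s (≤-trans (∣p∪q∣≤∣p∣+∣q∣ p q) (+-monoʳ-≤ ∣ p ∣ (n≤1+n _)))
∣p∪q∣≤∣p∣+∣q∣ (inside ∷ p)  (outside ∷ q) = s≤s (∣p∪q∣≤∣p∣+∣q∣ p q)
∣p∪q∣≤∣p∣+∣q∣ (outside ∷ p) (inside ∷ q)  = ≤-trans (s≤s (∣p∪q∣≤∣p∣+∣q∣ p q)) (≤-reflexive (sym (+-suc _ _)))
∣p∪q∣≤∣p∣+∣q∣ (outside ∷ p) (outside ∷ q) = ∣p∪q∣≤∣p∣+∣q∣ p q

∣⁅x⁆∪⁅y⁆∣≤2 : ∀ {n} (x y : Fin n) → ∣ ⁅ x ⁆ ∪ ⁅ y ⁆ ∣ ≤ 2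
∣⁅x⁆∪⁅y⁆∣≤2 x y = ≤-trans (∣p∪q∣≤∣p∣+∣q∣ ⁅ x ⁆ ⁅ y ⁆) (≤-reflexive (cong₂ _+_ (∣⁅x⁆∣≡1 x) (∣⁅x⁆∣≡1 y)))

3≤∣p∣ : ∀ {n} {p : Subset n} {x y z} → x ∈ p → y ∈ p → z ∈ p → x ≢ y → x ≢ z → y ≢ z → 3 ≤ ∣ p ∣
3≤∣p∣ {p = p} {x} {y} {z} x∈p y∈p z∈p x≢y x≢z y≢z =
  ≤-trans (s≤s (≤-trans (s≤s (≤-trans (s≤s z≤n) (x∈p⇒∣p-x∣<∣p∣ z∈p-x-y))) (x∈p⇒∣p-x∣<∣p∣ y∈p-x)))
          (x∈p⇒∣p-x∣<∣p∣ x∈p)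
  where
    y∈p-x : y ∈ p - x
    y∈p-x = x∈p∧x≢y⇒x∈p-y y∈p (x≢y ∘ sym)
    z∈p-x-y : z ∈ p - x - y
    z∈p-x-y = x∈p∧x≢y⇒x∈p-y (x∈p∧x≢y⇒x∈p-y z∈p (x≢z ∘ sym)) (y≢z ∘ sym)

below : ∀ {n} → ℕ → Subset n
below {zero}  _       = []
below {suc n} zero    = outside ∷ below zero
below {suc n} (suc k) = inside ∷ below k

∈-below⁺ : ∀ {n k} (i : Fin n) → toℕ i < k → i ∈ below k
∈-below⁺ {k = suc k} fzero    _         = here
∈-below⁺ {k = suc k} (fsuc i) (s≤s i<k) = there (∈-below⁺ i i<k)

∈-below⁻ : ∀ {n k} (i : Fin n) → i ∈ below k → toℕ i < k
∈-below⁻ {k = suc k} fzero    _         = s≤s z≤n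
∈-below⁻ {k = zero}  (fsuc i) (there i∈) = ⊥-elim (n≮0 (∈-below⁻ i i∈))
∈-below⁻ {k = suc k} (fsuc i) (there i∈) = s≤s (∈-below⁻ i i∈)

∣below∣ : ∀ {n} k → k ≤ n → ∣ below {n} k ∣ ≡ k
∣below∣ {zero}  zero    _         = refl
∣below∣ {suc n} zero    _         = ∣below∣ {n} zero z≤n
∣below∣ {suc n} (suc k) (s≤s k≤n) = cong suc (∣below∣ k k≤n)

chain-⊆ : ∀ {n k} (F : Fin (suc k) → Subset n) → (∀ i → F (inject₁ i) ⊆ F (fsuc i)) →
          ∀ d i j → toℕ j ≡ d + toℕ i → F i ⊆ F j
chain-⊆ F step zero    i j        j≡i rewrite toℕ-injective j≡i = λ x∈ → x∈
chain-⊆ F step (suc d) i fzero    ()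
chain-⊆ F step (suc d) i (fsuc j) j≡d+i =
  step j ∘ chain-⊆ F step d i (inject₁ j) (trans (toℕ-inject₁ j) (suc-injective j≡d+i))

flatChain-top : ∀ {n} {K : Pre n} {X} → HasFlatChain K X → Nonempty X →
  ∃ λ t → t ∈ X × ∃ λ F → Flat K F × t ∉ F × (∀ {y} → y ∈ X → y ≢ t → y ∈ F)
flatChain-top (zero , _ , _ , onto , _) (y , y∈X) with onto y y∈X
... | () , _
flatChain-top {X = X} (suc k , x , F , onto , x∈X , flats , F⊂ , new) _ =
  x last , x∈X last , F (inject₁ last) , flats (inject₁ last) , proj₂ (new last) , earlier
  where
    last : Fin (suc k)
    last = fromℕ k
    earlier : ∀ {y} → y ∈ X → y ≢ x last → y ∈ F (inject₁ last)
    earlier y∈X y≢t with onto _ y∈X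
    ... | j , refl = chain-⊆ F (proj₁ ∘ F⊂) (k ∸ suc (toℕ j)) (fsuc j) (inject₁ last) last≡ (proj₁ (new j))
      where
        j<k : toℕ j < k
        j<k = ≤∧≢⇒< (≤-pred (toℕ<n j)) (λ j≡k → y≢t (cong x (toℕ-injective (trans j≡k (sym (toℕ-fromℕ k))))))
        last≡ : toℕ (inject₁ last) ≡ k ∸ suc (toℕ j) + suc (toℕ j)
        last≡ = trans (trans (toℕ-inject₁ last) (toℕ-fromℕ k)) (sym (m∸n+n≡m j<k))

-- The BRSC of a closure system on W: its faces are the sets listed by strictly increasing chains of
-- closed sets.
module ClosureComplex {n} (W : Subset n) (Closed : Subset n → Set)
  (closed⊆W : ∀ {F} → Closed F → F ⊆ W) (closed-∅ : Closed ∅) (closed-W : Closed W)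
  (closed-∩ : ∀ {F G} → Closed F → Closed G → Closed (F ∩ G)) where

  data Chain : Subset n → Subset n → List (Fin n) → Set where
    done : ∀ {B} → Closed B → Chain B B []
    step : ∀ {B B′ C x xs} → Closed B → x ∉ B → x ∈ B′ → B ⊆ B′ → Chain B′ C xs → Chain B C (x ∷ xs)

  chain-single : ∀ {x} → x ∈ W → Chain ∅ W [ x ]
  chain-single x∈W = step closed-∅ ∉⊥ x∈W ⊥⊆ (done closed-W)

  data ChainFace (X : Subset n) : Set where
    chainFace : ∀ {B C xs} → Chain B C xs → Enumerates xs X → ChainFace X

  complex : Pre n
  complex = mkPre W ChainFace

  chain-closed : ∀ {B C xs} → Chain B C xs → Closed B
  chain-closed (done cB)          = cB
  chain-closed (step cB _ _ _ _)  = cB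

  chain-∉base : ∀ {B C xs y} → Chain B C xs → y ∈ˡ xs → y ∉ B
  chain-∉base (step _ x∉B _ _ _) (here refl) = x∉B
  chain-∉base (step _ _ _ B⊆ c)  (there y∈)  = chain-∉base c y∈ ∘ B⊆

  chain-⊆W : ∀ {B C xs y} → Chain B C xs → y ∈ˡ xs → y ∈ W
  chain-⊆W (step _ _ x∈ _ c) (here refl) = closed⊆W (chain-closed c) x∈
  chain-⊆W (step _ _ _ _ c)  (there y∈)  = chain-⊆W c y∈

  chain-filter : ∀ Y {B C xs} → Chain B C xs → ∃ λ B′ → B ⊆ B′ × Chain B′ C (filter (_∈? Y) xs)
  chain-filter Y (done cB) = _ , (λ x∈ → x∈) , done cB
  chain-filter Y (step {x = x} cB x∉B x∈ B⊆ c) with chain-filter Y c | x ∈? Y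
  ... | _ , B′⊆ , c′ | yes _ = _ , (λ y∈ → y∈) , step cB x∉B (B′⊆ x∈) (B′⊆ ∘ B⊆) c′
  ... | _ , B′⊆ , c′ | no _  = _ , B′⊆ ∘ B⊆ , c′

  chain-∩ : ∀ {F B C xs} → Closed F → Chain B C xs → (∀ {y} → y ∈ˡ xs → y ∈ F) → Chain (B ∩ F) (C ∩ F) xs
  chain-∩ cF (done cB) _ = done (closed-∩ cB cF)
  chain-∩ {F} cF (step {B} {B′} cB x∉B x∈ B⊆ c) xs⊆F =
    step (closed-∩ cB cF) (x∉B ∘ proj₁ ∘ x∈p∩q⁻ B F) (x∈p∩q⁺ (x∈ , xs⊆F (here refl)))
         (λ y∈ → x∈p∩q⁺ (B⊆ (proj₁ (x∈p∩q⁻ B F y∈)) , proj₂ (x∈p∩q⁻ B F y∈)))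
         (chain-∩ cF c (xs⊆F ∘ there))

  chain-snoc : ∀ {B C xs p} → Chain B C xs → p ∈ W → p ∉ C → Chain B W (xs ++ [ p ])
  chain-snoc (done cB)            p∈W p∉C = step cB p∉C p∈W (closed⊆W cB) (done closed-W)
  chain-snoc (step cB x∉ x∈ B⊆ c) p∈W p∉C = step cB x∉ x∈ B⊆ (chain-snoc c p∈W p∉C)

  closed⇒flat : ∀ {F} → Closed F → Flat complex F
  closed⇒flat {F} cF = closed⊆W cF , extend
    where
      extend : ∀ X p → ChainFace X → X ⊆ F → p ∈ W → p ∉ F → ChainFace (X ∪ ⁅ p ⁆)
      extend X p (chainFace c X≐xs) X⊆F p∈W p∉F =
        chainFace (chain-snoc (chain-∩ cF c (X⊆F ∘ proj₂ X≐xs)) p∈W (p∉F ∘ proj₂ ∘ x∈p∩q⁻ _ F))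
                  (Enumerates-++ X≐xs (Enumerates-⁅⁆ p))

  chainSets : ∀ {B C xs} → Chain B C xs → Fin (suc (length xs)) → Subset n
  chainSets {B} _ fzero              = B
  chainSets (step _ _ _ _ c) (fsuc i) = chainSets c i

  chainSets-closed : ∀ {B C xs} (c : Chain B C xs) j → Closed (chainSets c j)
  chainSets-closed c                fzero    = chain-closed c
  chainSets-closed (step _ _ _ _ c) (fsuc j) = chainSets-closed c j

  chainSets-⊆ : ∀ {B C xs} (c : Chain B C xs) i → chainSets c (inject₁ i) ⊆ chainSets c (fsuc i)
  chainSets-⊆ (step _ _ _ B⊆ c) fzero    = B⊆
  chainSets-⊆ (step _ _ _ _ c)  (fsuc i) = chainSets-⊆ c i

  chainSets-new : ∀ {B C xs} (c : Chain B C xs) i →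
                  lookup xs i ∈ chainSets c (fsuc i) × lookup xs i ∉ chainSets c (inject₁ i)
  chainSets-new (step _ x∉B x∈ _ c) fzero    = x∈ , x∉B
  chainSets-new (step _ _ _ _ c)    (fsuc i) = chainSets-new c i

  chainFace⇒flatChain : ∀ {X} → ChainFace X → HasFlatChain complex X
  chainFace⇒flatChain (chainFace {xs = xs} c (to , from)) =
    length xs , lookup xs , chainSets c ,
    (λ y y∈X → index (to y∈X) , sym (lookup-index (to y∈X))) ,
    (λ i → from (∈-lookup i)) ,
    closed⇒flat ∘ chainSets-closed c ,
    (λ i → chainSets-⊆ c i , lookup xs i , chainSets-new c i) ,
    chainSets-new c

  complex-isSC : Nonempty W → IsSC complex
  complex-isSC ne = record
    { V-nonempty  = ne
    ; faces⊆V     = λ { X (chainFace c (to , _)) → chain-⊆W c ∘ to }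
    ; singletons  = λ x x∈W → chainFace (chain-single x∈W) (Enumerates-⁅⁆ x)
    ; down-closed = λ { X Y (chainFace {xs = xs} c (to , _)) Y⊆X →
        chainFace (proj₂ (proj₂ (chain-filter Y c)))
                  ((λ y∈Y → ∈-filter⁺ (_∈? Y) (to (Y⊆X y∈Y)) y∈Y) , proj₂ ∘ ∈-filter⁻ (_∈? Y) {xs = xs}) }
    }

  complex-BRSC : Nonempty W → BRSC complex
  complex-BRSC ne = complex-isSC ne , λ _ → chainFace⇒flatChain

-- T lists, in increasing order, the 3-sets that are not faces; Sym is its symmetric closure.
module Triples {n} (T : Fin n → Fin n → Fin n → Set)
  (T-increasing : ∀ {a b c} → T a b c → a Fin.< b × b Fin.< c) where

  data Sym (a b c : Fin n) : Set where
    abc : T a b c → Sym a b c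
    acb : T a c b → Sym a b c
    bac : T b a c → Sym a b c
    bca : T b c a → Sym a b c
    cab : T c a b → Sym a b c
    cba : T c b a → Sym a b c

  Sym-swap : ∀ {a b c} → Sym a b c → Sym b a c
  Sym-swap (abc t) = bac t
  Sym-swap (acb t) = bca t
  Sym-swap (bac t) = abc t
  Sym-swap (bca t) = acb t
  Sym-swap (cab t) = cba t
  Sym-swap (cba t) = cab t

  Sym-rot : ∀ {a b c} → Sym a b c → Sym b c a
  Sym-rot (abc t) = cab t
  Sym-rot (acb t) = cba t
  Sym-rot (bac t) = acb t
  Sym-rot (bca t) = abc t
  Sym-rot (cab t) = bca t
  Sym-rot (cba t) = bac t

  Sym-distinct : ∀ {a b c} → Sym a b c → a ≢ b
  Sym-distinct s refl = <-irrefl refl (order s)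
    where
      order : ∀ {a c} → Sym a a c → toℕ a < toℕ a
      order (abc t) = proj₁ (T-increasing t)
      order (acb t) = uncurry <-trans (T-increasing t)
      order (bac t) = proj₁ (T-increasing t)
      order (bca t) = uncurry <-trans (T-increasing t)
      order (cab t) = proj₂ (T-increasing t)
      order (cba t) = proj₂ (T-increasing t)

  Sym-sort : ∀ {a b c} → Sym a b c → a Fin.< b → b Fin.< c → T a b c
  Sym-sort (abc t) _   _   = t
  Sym-sort (acb t) _   b<c = ⊥-elim (<-asym b<c (proj₂ (T-increasing t)))
  Sym-sort (bac t) a<b _   = ⊥-elim (<-asym a<b (proj₁ (T-increasing t)))
  Sym-sort (bca t) a<b b<c = ⊥-elim (<-asym (<-trans a<b b<c) (proj₂ (T-increasing t)))
  Sym-sort (cab t) a<b b<c = ⊥-elim (<-asym (<-trans a<b b<c) (proj₁ (T-increasing t)))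
  Sym-sort (cba t) _   b<c = ⊥-elim (<-asym b<c (proj₁ (T-increasing t)))

  Sym-cases : ∀ {u v p} → Sym u v p → u Fin.< v → T p u v ⊎ T u p v ⊎ T u v p
  Sym-cases {u} {v} {p} s u<v with Finₚ.<-cmp p u
  ... | tri< p<u _ _ = inj₁ (Sym-sort (Sym-rot (Sym-rot s)) p<u u<v)
  ... | tri≈ _ p≡u _ = ⊥-elim (Sym-distinct (Sym-rot (Sym-rot s)) p≡u)
  ... | tri> _ _ u<p with Finₚ.<-cmp p v
  ...   | tri< p<v _ _ = inj₂ (inj₁ (Sym-sort (Sym-swap (Sym-rot (Sym-rot s))) u<p p<v))
  ...   | tri≈ _ p≡v _ = ⊥-elim (Sym-distinct (Sym-rot s) (sym p≡v))
  ...   | tri> _ _ v<p = inj₂ (inj₂ (Sym-sort s u<v v<p))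

  Free : Subset n → Set
  Free X = ∀ {a b c} → a ∈ X → b ∈ X → c ∈ X → ¬ T a b c

  free⇒¬Sym : ∀ {X u v w} → Free X → u ∈ X → v ∈ X → w ∈ X → ¬ Sym u v w
  free⇒¬Sym free u∈ v∈ w∈ (abc t) = free u∈ v∈ w∈ t
  free⇒¬Sym free u∈ v∈ w∈ (acb t) = free u∈ w∈ v∈ t
  free⇒¬Sym free u∈ v∈ w∈ (bac t) = free v∈ u∈ w∈ t
  free⇒¬Sym free u∈ v∈ w∈ (bca t) = free v∈ w∈ u∈ t
  free⇒¬Sym free u∈ v∈ w∈ (cab t) = free w∈ u∈ v∈ t
  free⇒¬Sym free u∈ v∈ w∈ (cba t) = free w∈ v∈ u∈ t

  small⇒free : ∀ {X} → ∣ X ∣ ≤ 2 → Free X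
  small⇒free ∣X∣≤2 a∈ b∈ c∈ t =
    <⇒≱ (3≤∣p∣ a∈ b∈ c∈ (Finₚ.<⇒≢ a<b) (Finₚ.<⇒≢ (<-trans a<b b<c)) (Finₚ.<⇒≢ b<c)) ∣X∣≤2
    where
      a<b : _ Fin.< _
      a<b = proj₁ (T-increasing t)
      b<c : _ Fin.< _
      b<c = proj₂ (T-increasing t)

  freeComplex : Pre n
  freeComplex = mkPre ⊤ (λ X → ∣ X ∣ ≤ 3 × Free X)

  small-face : ∀ {X} → ∣ X ∣ ≤ 2 → H freeComplex X
  small-face ∣X∣≤2 = ≤-trans ∣X∣≤2 (n≤1+n 2) , small⇒free ∣X∣≤2

  freeComplex-isSC : Fin n → IsSC freeComplex
  freeComplex-isSC x = record
    { V-nonempty  = x , ∈⊤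
    ; faces⊆V     = λ _ _ → ⊆⊤
    ; singletons  = λ y _ → small-face (≤-trans (≤-reflexive (∣⁅x⁆∣≡1 y)) (n≤1+n 1))
    ; down-closed = λ X Y (∣X∣≤3 , free) Y⊆X →
        ≤-trans (p⊆q⇒∣p∣≤∣q∣ Y⊆X) ∣X∣≤3 , λ a∈ b∈ c∈ → free (Y⊆X a∈) (Y⊆X b∈) (Y⊆X c∈)
    }

  restrict-paving : ∀ W → Paving (restrict freeComplex W)
  restrict-paving W d ((S , ((∣S∣≤3 , _) , _) , ∣S∣≡d) , _) X X⊆W ∣X∣≤d-1 =
    small-face ∣X∣≤2 , X⊆W
    where
      ∣X∣≤2 : ∣ X ∣ ≤ 2
      ∣X∣≤2 = ≤-trans ∣X∣≤d-1 (∸-monoˡ-≤ 1 (subst (_≤ 3) ∣S∣≡d ∣S∣≤3))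

  ClosedIn : Subset n → Subset n → Set
  ClosedIn W F = F ⊆ W × (∀ {u v p} → u ∈ F → v ∈ F → p ∈ W → Sym u v p → p ∈ F)

  closedIn-∅ : ∀ {W} → ClosedIn W ∅
  closedIn-∅ = ⊥⊆ , λ u∈∅ → ⊥-elim (∉⊥ u∈∅)

  closedIn-W : ∀ {W} → ClosedIn W W
  closedIn-W = (λ x∈ → x∈) , λ _ _ p∈W _ → p∈W

  closedIn-∩ : ∀ {W F G} → ClosedIn W F → ClosedIn W G → ClosedIn W (F ∩ G)
  closedIn-∩ {F = F} {G} (F⊆W , closeF) (_ , closeG) =
    F⊆W ∘ proj₁ ∘ x∈p∩q⁻ F G ,
    λ u∈ v∈ p∈W s → x∈p∩q⁺ ( closeF (proj₁ (x∈p∩q⁻ F G u∈)) (proj₁ (x∈p∩q⁻ F G v∈)) p∈W s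
                           , closeG (proj₂ (x∈p∩q⁻ F G u∈)) (proj₂ (x∈p∩q⁻ F G v∈)) p∈W s)

  NoThird : Fin n → Fin n → Set
  NoThird u v = ∀ p → ¬ Sym u v p

  pair-closedIn : ∀ {W u v} → u ∈ W → v ∈ W → NoThird u v → ClosedIn W (⁅ u ⁆ ∪ ⁅ v ⁆)
  pair-closedIn {W} {u} {v} u∈W v∈W noThird = pair⊆W , λ a∈ b∈ _ s → ⊥-elim (noSym (cases a∈) (cases b∈) s)
    where
      cases : ∀ {a} → a ∈ ⁅ u ⁆ ∪ ⁅ v ⁆ → a ≡ u ⊎ a ≡ v
      cases a∈ with x∈p∪q⁻ ⁅ u ⁆ ⁅ v ⁆ a∈
      ... | inj₁ a∈⁅u⁆ = inj₁ (x∈⁅y⁆⇒x≡y u a∈⁅u⁆)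
      ... | inj₂ a∈⁅v⁆ = inj₂ (x∈⁅y⁆⇒x≡y v a∈⁅v⁆)
      pair⊆W : ⁅ u ⁆ ∪ ⁅ v ⁆ ⊆ W
      pair⊆W a∈ with cases a∈
      ... | inj₁ refl = u∈W
      ... | inj₂ refl = v∈W
      noSym : ∀ {a b p} → a ≡ u ⊎ a ≡ v → b ≡ u ⊎ b ≡ v → ¬ Sym a b p
      noSym (inj₁ refl) (inj₁ refl) s = Sym-distinct s refl
      noSym (inj₂ refl) (inj₂ refl) s = Sym-distinct s refl
      noSym (inj₁ refl) (inj₂ refl) s = noThird _ s
      noSym (inj₂ refl) (inj₁ refl) s = noThird _ (Sym-swap s)

  singleton-closedIn : ∀ {W u} → u ∈ W → ClosedIn W ⁅ u ⁆
  singleton-closedIn {u = u} u∈W =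
    (λ a∈ → subst (_∈ _) (sym (x∈⁅y⁆⇒x≡y u a∈)) u∈W) ,
    λ a∈ b∈ _ s → ⊥-elim (Sym-distinct s (trans (x∈⁅y⁆⇒x≡y u a∈) (sym (x∈⁅y⁆⇒x≡y u b∈))))

  closedIn-extend : ∀ {W B x u v w} → ClosedIn W B → x ∉ B → x ∈ W → Sym u v w →
                    u ∈ B ⊎ u ≡ x → v ∈ B ⊎ v ≡ x → w ∈ B ⊎ w ≡ x → u ∈ B × v ∈ B × w ∈ B
  closedIn-extend _ _ _ _ (inj₁ u∈) (inj₁ v∈) (inj₁ w∈) = u∈ , v∈ , w∈
  closedIn-extend (_ , close) x∉B x∈W s (inj₁ u∈) (inj₁ v∈) (inj₂ refl) =
    ⊥-elim (x∉B (close u∈ v∈ x∈W s))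
  closedIn-extend (_ , close) x∉B x∈W s (inj₁ u∈) (inj₂ refl) (inj₁ w∈) =
    ⊥-elim (x∉B (close u∈ w∈ x∈W (Sym-swap (Sym-rot (Sym-rot s)))))
  closedIn-extend (_ , close) x∉B x∈W s (inj₂ refl) (inj₁ v∈) (inj₁ w∈) =
    ⊥-elim (x∉B (close v∈ w∈ x∈W (Sym-rot s)))
  closedIn-extend _ _ _ s (inj₂ refl) (inj₂ refl) _ = ⊥-elim (Sym-distinct s refl)
  closedIn-extend _ _ _ s (inj₂ refl) _ (inj₂ refl) = ⊥-elim (Sym-distinct (Sym-rot (Sym-rot s)) refl)
  closedIn-extend _ _ _ s _ (inj₂ refl) (inj₂ refl) = ⊥-elim (Sym-distinct (Sym-rot s) refl)

  module Restriction (W : Subset n) where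
    open ClosureComplex W (ClosedIn W) proj₁ closedIn-∅ closedIn-W closedIn-∩

    -- The last point of a triple to enter the chain would already be forced into the closed set before it.
    chain-free : ∀ {B B′ xs u v w} → Chain B B′ xs → Sym u v w →
                 u ∈ B ⊎ u ∈ˡ xs → v ∈ B ⊎ v ∈ˡ xs → w ∈ B ⊎ w ∈ˡ xs → u ∈ B × v ∈ B × w ∈ B
    chain-free {B} (done _) _ u∈ v∈ w∈ = inB u∈ , inB v∈ , inB w∈
      where
        inB : ∀ {y} → y ∈ B ⊎ y ∈ˡ [] → y ∈ B
        inB (inj₁ y∈B) = y∈B
    chain-free {B} {xs = x ∷ xs} {u} {v} {w} (step {B′ = C} cB x∉B x∈C B⊆C c) s u∈ v∈ w∈ =
      closedIn-extend cB x∉B (proj₁ (chain-closed c) x∈C) s (narrow u∈ u∈C) (narrow v∈ v∈C) (narrow w∈ w∈C)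
      where
        lift : ∀ {y} → y ∈ B ⊎ y ∈ˡ x ∷ xs → y ∈ C ⊎ y ∈ˡ xs
        lift (inj₁ y∈B)          = inj₁ (B⊆C y∈B)
        lift (inj₂ (here refl))  = inj₁ x∈C
        lift (inj₂ (there y∈xs)) = inj₂ y∈xs
        narrow : ∀ {y} → y ∈ B ⊎ y ∈ˡ x ∷ xs → y ∈ C → y ∈ B ⊎ y ≡ x
        narrow (inj₁ y∈B)          _   = inj₁ y∈B
        narrow (inj₂ (here refl))  _   = inj₂ refl
        narrow (inj₂ (there y∈xs)) y∈C = ⊥-elim (chain-∉base c y∈xs y∈C)
        inC : u ∈ C × v ∈ C × w ∈ C
        inC = chain-free c s (lift u∈) (lift v∈) (lift w∈)
        u∈C : u ∈ C
        u∈C = proj₁ inC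
        v∈C : v ∈ C
        v∈C = proj₁ (proj₂ inC)
        w∈C : w ∈ C
        w∈C = proj₂ (proj₂ inC)

    chainFace⇒free : ∀ {X} → ChainFace X → Free X
    chainFace⇒free (chainFace c (to , _)) a∈ b∈ c∈ t =
      chain-∉base c (to a∈) (proj₁ (chain-free c (abc t) (inj₂ (to a∈)) (inj₂ (to b∈)) (inj₂ (to c∈))))

    Separates : Subset n → Fin n → Fin n → Fin n → Set
    Separates F a b c = ClosedIn W F × a ∈ F × b ∈ F × c ∉ F

    Separable : Fin n → Fin n → Fin n → Set
    Separable x y z = ∃ λ F → Separates F x y z ⊎ Separates F x z y ⊎ Separates F y z x

    pair-separates : ∀ {a b c} → a ∈ W → b ∈ W → NoThird a b → c ≢ a → c ≢ b → Separates (⁅ a ⁆ ∪ ⁅ b ⁆) a b c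
    pair-separates {a} {b} a∈W b∈W noThird c≢a c≢b =
      pair-closedIn a∈W b∈W noThird , p⊆p∪q ⁅ b ⁆ (x∈⁅x⁆ a) , q⊆p∪q ⁅ a ⁆ ⁅ b ⁆ (x∈⁅x⁆ b) , c∉
      where
        c∉ : _ ∉ ⁅ a ⁆ ∪ ⁅ b ⁆
        c∉ c∈ with x∈p∪q⁻ ⁅ a ⁆ ⁅ b ⁆ c∈
        ... | inj₁ c∈⁅a⁆ = c≢a (x∈⁅y⁆⇒x≡y a c∈⁅a⁆)
        ... | inj₂ c∈⁅b⁆ = c≢b (x∈⁅y⁆⇒x≡y b c∈⁅b⁆)

    chain-pair : ∀ {a b} → a ∈ W → b ∈ W → a ≢ b → Chain ∅ W (a ∷ b ∷ [])
    chain-pair {a} a∈W b∈W a≢b =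
      step closedIn-∅ ∉⊥ (x∈⁅x⁆ a) ⊥⊆
        (step (singleton-closedIn a∈W) (x≢y⇒x∉⁅y⁆ (a≢b ∘ sym)) b∈W (proj₁ (singleton-closedIn a∈W))
          (done closedIn-W))

    chain-separated : ∀ {F a b c} → Separates F a b c → a ≢ b → c ∈ W → Chain ∅ W (a ∷ b ∷ c ∷ [])
    chain-separated {F} {a} (cF , a∈F , b∈F , c∉F) a≢b c∈W =
      step closedIn-∅ ∉⊥ (x∈⁅x⁆ a) ⊥⊆
        (step (singleton-closedIn (proj₁ cF a∈F)) (x≢y⇒x∉⁅y⁆ (a≢b ∘ sym)) b∈F ⁅a⁆⊆F
          (step cF c∉F c∈W (proj₁ cF) (done closedIn-W)))
      where
        ⁅a⁆⊆F : ⁅ a ⁆ ⊆ F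
        ⁅a⁆⊆F x∈ = subst (_∈ F) (sym (x∈⁅y⁆⇒x≡y a x∈)) a∈F

    AllSeparable : Set
    AllSeparable = ∀ {x y z} → x Fin.< y → y Fin.< z → x ∈ W → y ∈ W → z ∈ W → ¬ T x y z → Separable x y z

    triple⇒chainFace : AllSeparable → ∀ {X x y z} → Free X → X ⊆ W → Enumerates (x ∷ y ∷ z ∷ []) X →
                       x Fin.< y → y Fin.< z → ChainFace X
    triple⇒chainFace separable {X} {x} {y} {z} free X⊆W X≐ x<y y<z =
      fromSeparable (separable x<y y<z (X⊆W x∈) (X⊆W y∈) (X⊆W z∈) (free x∈ y∈ z∈))
      where
        x∈ : x ∈ X
        x∈ = proj₂ X≐ (here refl)
        y∈ : y ∈ X
        y∈ = proj₂ X≐ (there (here refl))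
        z∈ : z ∈ X
        z∈ = proj₂ X≐ (there (there (here refl)))
        fromSeparable : Separable x y z → ChainFace X
        fromSeparable (_ , inj₁ sep) =
          chainFace (chain-separated sep (Finₚ.<⇒≢ x<y) (X⊆W z∈)) X≐
        fromSeparable (_ , inj₂ (inj₁ sep)) =
          chainFace (chain-separated sep (Finₚ.<⇒≢ (<-trans x<y y<z)) (X⊆W y∈))
                    (Enumerates-↭ (↭-prep x (↭-swap y z ↭-refl)) X≐)
        fromSeparable (_ , inj₂ (inj₂ sep)) =
          chainFace (chain-separated sep (Finₚ.<⇒≢ y<z) (X⊆W x∈))
                    (Enumerates-↭ (↭-trans (↭-swap x y ↭-refl) (↭-prep y (↭-swap x z ↭-refl))) X≐)

    free⇒chainFace : AllSeparable → ∀ {X} → ∣ X ∣ ≤ 3 → Free X → X ⊆ W → ChainFace X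
    free⇒chainFace separable {X} ∣X∣≤3 free X⊆W
      with enum X | enum-enumerates X | length-enum X | enum-sorted X
    ... | []     | X≐ | _ | _ = chainFace (done closedIn-∅) X≐
    ... | _ ∷ [] | X≐ | _ | _ = chainFace (chain-single (X⊆W (proj₂ X≐ (here refl)))) X≐
    ... | _ ∷ _ ∷ [] | X≐ | _ | x<y ∷ _ =
      chainFace (chain-pair (X⊆W (proj₂ X≐ (here refl))) (X⊆W (proj₂ X≐ (there (here refl))))
                            (Finₚ.<⇒≢ x<y)) X≐
    ... | _ ∷ _ ∷ _ ∷ [] | X≐ | _ | x<y ∷ y<z ∷ [-] = triple⇒chainFace separable free X⊆W X≐ x<y y<z
    ... | _ ∷ _ ∷ _ ∷ _ ∷ _ | _ | length≡∣X∣ | _ =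
      ⊥-elim (<⇒≱ (≤-trans (s≤s (s≤s (s≤s (s≤s z≤n)))) (≤-reflexive length≡∣X∣)) ∣X∣≤3)

    restriction-TBP₂ : Nonempty W → AllSeparable → TBP₂ (restrict freeComplex W)
    restriction-TBP₂ ne separable =
      (complex , 3 , s≤s z≤n , complex-BRSC ne , truncation) ,
      restrict-paving W , λ _ face → proj₁ (proj₁ face)
      where
        truncation : IsTruncation (restrict freeComplex W) complex 3
        truncation = refl , λ X →
          (λ { ((∣X∣≤3 , free) , X⊆W) → free⇒chainFace separable ∣X∣≤3 free X⊆W , ∣X∣≤3 }) ,
          (λ { (face , ∣X∣≤3) → (∣X∣≤3 , chainFace⇒free face) , IsSC.faces⊆V (complex-isSC ne) X face })

  truncation-flat⇒closed : ∀ {L k} → IsTruncation freeComplex L k → 3 ≤ k → ∀ {F} → Flat L F → ClosedIn ⊤ F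
  truncation-flat⇒closed {L} {k} (V≡ , trunc) 3≤k {F} (_ , flat) = ⊆⊤ , close
    where
      close : ∀ {u v p} → u ∈ F → v ∈ F → p ∈ ⊤ → Sym u v p → p ∈ F
      close {u} {v} {p} u∈F v∈F _ s with p ∈? F
      ... | yes p∈F = p∈F
      ... | no  p∉F = ⊥-elim (free⇒¬Sym (proj₂ tripleK) (inPair (p⊆p∪q ⁅ v ⁆ (x∈⁅x⁆ u)))
                                         (inPair (q⊆p∪q ⁅ u ⁆ ⁅ v ⁆ (x∈⁅x⁆ v))) (q⊆p∪q pair ⁅ p ⁆ (x∈⁅x⁆ p)) s)
        where
          pair : Subset n
          pair = ⁅ u ⁆ ∪ ⁅ v ⁆
          inPair : ∀ {y} → y ∈ pair → y ∈ pair ∪ ⁅ p ⁆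
          inPair = p⊆p∪q ⁅ p ⁆
          pair⊆F : pair ⊆ F
          pair⊆F y∈ with x∈p∪q⁻ ⁅ u ⁆ ⁅ v ⁆ y∈
          ... | inj₁ y∈⁅u⁆ = subst (_∈ F) (sym (x∈⁅y⁆⇒x≡y u y∈⁅u⁆)) u∈F
          ... | inj₂ y∈⁅v⁆ = subst (_∈ F) (sym (x∈⁅y⁆⇒x≡y v y∈⁅v⁆)) v∈F
          ∣pair∣≤2 : ∣ pair ∣ ≤ 2
          ∣pair∣≤2 = ∣⁅x⁆∪⁅y⁆∣≤2 u v
          pairL : H L pair
          pairL = proj₁ (proj₁ (trunc pair) (small-face ∣pair∣≤2))
          ∣triple∣≤3 : ∣ pair ∪ ⁅ p ⁆ ∣ ≤ 3
          ∣triple∣≤3 = ≤-trans (∣p∪q∣≤∣p∣+∣q∣ pair ⁅ p ⁆) (+-mono-≤ ∣pair∣≤2 (≤-reflexive (∣⁅x⁆∣≡1 p)))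
          tripleK : H freeComplex (pair ∪ ⁅ p ⁆)
          tripleK = proj₂ (trunc _)
            (flat pair p pairL pair⊆F (subst (p ∈_) V≡ ∈⊤) p∉F , ≤-trans ∣triple∣≤3 3≤k)

  Dependent : Subset n → Set
  Dependent X = ∀ {F} → ClosedIn ⊤ F → ∀ {t} → t ∈ X → (∀ {y} → y ∈ X → y ≢ t → y ∈ F) → t ∈ F

  dependent⇒¬TBP₂ : ∀ {X} → ∣ X ∣ ≡ 3 → Free X → Nonempty X → Dependent X → ¬ TBP₂ freeComplex
  dependent⇒¬TBP₂ {X} ∣X∣≡3 free ne dependent ((L , k , _ , (_ , flatChains) , trunc) , _) =
    let X∈L , ∣X∣≤k = proj₁ (proj₂ trunc X) (≤-reflexive ∣X∣≡3 , free)
        t , t∈X , F , flat , t∉F , rest = flatChain-top (flatChains X X∈L) ne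
    in t∉F (dependent (truncation-flat⇒closed trunc (subst (_≤ k) ∣X∣≡3 ∣X∣≤k) flat) t∈X rest)

module Construction (m : ℕ) where

  -- [2, q] is too large to fit in a W of size m, and q ≥ 6 as classify needs.
  q : ℕ
  q = 8 + m

  N : ℕ
  N = 2 + q

  data Forbidden (a b c : ℕ) : Set where
    consecutive : b ≡ suc a → c ≡ suc b → Forbidden a b c
    long        : a ≤ 1 → b ≡ q → c ≡ suc q → Forbidden a b c

  Forbidden-increasing : ∀ {a b c} → Forbidden a b c → a < b × b < c
  Forbidden-increasing (consecutive refl refl) = n<1+n _ , n<1+n _
  Forbidden-increasing (long a≤1 refl refl)    = ≤-trans (s≤s a≤1) (s≤s (s≤s z≤n)) , n<1+n _

  Forbidden-top : ∀ {a b c} → Forbidden a b c → c ≡ suc b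
  Forbidden-top (consecutive _ c≡) = c≡
  Forbidden-top (long _ refl c≡)   = c≡

  Line : Fin N → Fin N → Fin N → Set
  Line x y z = Forbidden (toℕ x) (toℕ y) (toℕ z)

  open Triples Line Forbidden-increasing

  K : Pre N
  K = freeComplex

  -- The vertex numbered t lies in F; vacuous when t ≥ N.
  Has : Subset N → ℕ → Set
  Has F t = ∀ {i} → toℕ i ≡ t → i ∈ F

  has : ∀ {F i} → i ∈ F → Has F (toℕ i)
  has {F} i∈F k≡i = subst (_∈ F) (sym (toℕ-injective k≡i)) i∈F

  Has-close : ∀ {F a b c} → ClosedIn ⊤ F → a < N → b < N → Has F a → Has F b →
              Forbidden a b c ⊎ Forbidden a c b ⊎ Forbidden c a b → Has F c
  Has-close {a = a} {b} cF a<N b<N hasA hasB f {k} k≡c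
    with fromℕ< a<N | toℕ-fromℕ< a<N | fromℕ< b<N | toℕ-fromℕ< b<N | k≡c
  ... | i | refl | j | refl | refl = proj₂ cF (hasA refl) (hasB refl) ∈⊤ (line f)
    where
      line : Line i j k ⊎ Line i k j ⊎ Line k i j → Sym i j k
      line (inj₁ f)        = abc f
      line (inj₂ (inj₁ f)) = acb f
      line (inj₂ (inj₂ f)) = cab f

  Has-up : ∀ {F t} → ClosedIn ⊤ F → Has F t → Has F (suc t) → Has F (2 + t)
  Has-up cF hasT hasT+1 {k} k≡ =
    Has-close cF (<-trans (n<1+n _) t+1<N) t+1<N hasT hasT+1 (inj₁ (consecutive refl refl)) k≡
    where
      t+1<N : 1 + _ < N
      t+1<N = <-trans (n<1+n _) (subst (_< N) k≡ (toℕ<n k))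

  Has-down : ∀ {F t} → ClosedIn ⊤ F → 2 + t < N → Has F (suc t) → Has F (2 + t) → Has F t
  Has-down cF t+2<N hasT+1 hasT+2 =
    Has-close cF (<-trans (n<1+n _) t+2<N) t+2<N hasT+1 hasT+2 (inj₂ (inj₂ (consecutive refl refl)))

  Has-upward : ∀ {F s} → ClosedIn ⊤ F → Has F s → Has F (suc s) → ∀ {t} → s ≤′ t → Has F t × Has F (suc t)
  Has-upward cF hasS hasS+1 ≤′-refl         = hasS , hasS+1
  Has-upward cF hasS hasS+1 (≤′-step s≤′t) with Has-upward cF hasS hasS+1 s≤′t
  ... | hasT , hasT+1 = hasT+1 , Has-up cF hasT hasT+1

  Has-downward : ∀ {F s t} → ClosedIn ⊤ F → s ≤′ t → suc t < N → Has F t → Has F (suc t) → Has F s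
  Has-downward cF ≤′-refl         _     hasT _      = hasT
  Has-downward cF (≤′-step s≤′t) t+2<N hasT+1 hasT+2 =
    Has-downward cF s≤′t (<-trans (n<1+n _) t+2<N) (Has-down cF t+2<N hasT+1 hasT+2) hasT+1

  e₀ e₁ e₊ : Fin N
  e₀ = fzero
  e₁ = fsuc fzero
  e₊ = fromℕ (suc q)

  triple : Subset N
  triple = ⁅ e₀ ⁆ ∪ ⁅ e₁ ⁆ ∪ ⁅ e₊ ⁆

  e₀∈ : e₀ ∈ triple
  e₀∈ = p⊆p∪q (⁅ e₁ ⁆ ∪ ⁅ e₊ ⁆) (x∈⁅x⁆ e₀)

  e₁∈ : e₁ ∈ triple
  e₁∈ = q⊆p∪q ⁅ e₀ ⁆ (⁅ e₁ ⁆ ∪ ⁅ e₊ ⁆) (p⊆p∪q ⁅ e₊ ⁆ (x∈⁅x⁆ e₁))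

  e₊∈ : e₊ ∈ triple
  e₊∈ = q⊆p∪q ⁅ e₀ ⁆ (⁅ e₁ ⁆ ∪ ⁅ e₊ ⁆) (q⊆p∪q ⁅ e₁ ⁆ ⁅ e₊ ⁆ (x∈⁅x⁆ e₊))

  triple-cases : ∀ {t} → t ∈ triple → t ≡ e₀ ⊎ t ≡ e₁ ⊎ t ≡ e₊
  triple-cases t∈ with x∈p∪q⁻ ⁅ e₀ ⁆ (⁅ e₁ ⁆ ∪ ⁅ e₊ ⁆) t∈
  ... | inj₁ t∈₀ = inj₁ (x∈⁅y⁆⇒x≡y e₀ t∈₀)
  ... | inj₂ t∈₁₊ with x∈p∪q⁻ ⁅ e₁ ⁆ ⁅ e₊ ⁆ t∈₁₊
  ...   | inj₁ t∈₁ = inj₂ (inj₁ (x∈⁅y⁆⇒x≡y e₁ t∈₁))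
  ...   | inj₂ t∈₊ = inj₂ (inj₂ (x∈⁅y⁆⇒x≡y e₊ t∈₊))

  ∣triple∣≡3 : ∣ triple ∣ ≡ 3
  ∣triple∣≡3 = ≤-antisym ∣triple∣≤3 (3≤∣p∣ e₀∈ e₁∈ e₊∈ (λ ()) (λ ()) (λ ()))
    where
      ∣triple∣≤3 : ∣ triple ∣ ≤ 3
      ∣triple∣≤3 = ≤-trans (∣p∪q∣≤∣p∣+∣q∣ ⁅ e₀ ⁆ (⁅ e₁ ⁆ ∪ ⁅ e₊ ⁆))
                    (+-mono-≤ (≤-reflexive (∣⁅x⁆∣≡1 e₀)) (∣⁅x⁆∪⁅y⁆∣≤2 e₁ e₊))

  Value : ℕ → Set
  Value v = v ≡ 0 ⊎ v ≡ 1 ⊎ v ≡ suc q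

  triple-values : ∀ {t} → t ∈ triple → Value (toℕ t)
  triple-values t∈ with triple-cases t∈
  ... | inj₁ refl        = inj₁ refl
  ... | inj₂ (inj₁ refl) = inj₂ (inj₁ refl)
  ... | inj₂ (inj₂ refl) = inj₂ (inj₂ (toℕ-fromℕ (suc q)))

  successive-values : ∀ {u v} → Value u → Value v → v ≡ suc u → u ≡ 0
  successive-values (inj₁ refl)        _                  _   = refl
  successive-values (inj₂ (inj₁ refl)) (inj₁ refl)        ()
  successive-values (inj₂ (inj₁ refl)) (inj₂ (inj₁ refl)) ()
  successive-values (inj₂ (inj₁ refl)) (inj₂ (inj₂ refl)) ()
  successive-values (inj₂ (inj₂ refl)) (inj₁ refl)        ()
  successive-values (inj₂ (inj₂ refl)) (inj₂ (inj₁ refl)) ()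
  successive-values (inj₂ (inj₂ refl)) (inj₂ (inj₂ refl)) q+1≡q+2 = ⊥-elim (<-irrefl q+1≡q+2 (n<1+n _))

  triple-free : Free triple
  triple-free a∈ b∈ c∈ f with successive-values (triple-values b∈) (triple-values c∈) (Forbidden-top f)
  ... | b≡0 = n≮0 (subst (_ <_) b≡0 (proj₁ (Forbidden-increasing f)))

  has-e₊ : ∀ {F} → e₊ ∈ F → Has F (suc q)
  has-e₊ e₊∈F k≡ = has e₊∈F (trans k≡ (sym (toℕ-fromℕ (suc q))))

  has-q : ∀ {F i} → ClosedIn ⊤ F → toℕ i ≤ 1 → i ∈ F → e₊ ∈ F → Has F q
  has-q {i = i} cF i≤1 i∈F e₊∈F =
    Has-close cF (toℕ<n i) (n<1+n _) (has i∈F) (has-e₊ e₊∈F) (inj₂ (inj₁ (long i≤1 refl refl)))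

  triple-dependent : Dependent triple
  triple-dependent {F} cF t∈ others with triple-cases t∈
  ... | inj₁ refl =
    Has-downward cF (≤⇒≤′ z≤n) ≤-refl (has-q cF (s≤s z≤n) (others e₁∈ (λ ())) e₊∈F) (has-e₊ e₊∈F) refl
    where
      e₊∈F : e₊ ∈ F
      e₊∈F = others e₊∈ (λ ())
  ... | inj₂ (inj₁ refl) =
    Has-downward cF (≤⇒≤′ (s≤s z≤n)) ≤-refl (has-q cF z≤n (others e₀∈ (λ ())) e₊∈F) (has-e₊ e₊∈F) refl
    where
      e₊∈F : e₊ ∈ F
      e₊∈F = others e₊∈ (λ ())
  ... | inj₂ (inj₂ refl) =
    proj₁ (Has-upward cF (has (others e₀∈ (λ ()))) (has (others e₁∈ (λ ()))) (≤⇒≤′ z≤n)) (toℕ-fromℕ (suc q))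

  K-isSC : IsSC K
  K-isSC = freeComplex-isSC fzero

  K-¬TBP₂ : ¬ TBP₂ K
  K-¬TBP₂ = dependent⇒¬TBP₂ ∣triple∣≡3 triple-free (e₀ , e₀∈) triple-dependent

  FarPair : ℕ → ℕ → Set
  FarPair a b = 2 + a < b × (a ≤ 1 → b < q)

  farPair⇒noThird : ∀ {u v} → FarPair (toℕ u) (toℕ v) → NoThird u v
  farPair⇒noThird {u} {v} (far , notLong) p s with Sym-cases s (≤-trans (s≤s (m≤n+m _ 2)) far)
  ... | inj₁ f                          = <⇒≱ far (≤-trans (≤-reflexive (Forbidden-top f)) (n≤1+n _))
  ... | inj₂ (inj₁ (consecutive p≡ v≡)) = <⇒≱ far (≤-reflexive (trans v≡ (cong suc p≡)))
  ... | inj₂ (inj₁ (long u≤1 _ v≡))     = <⇒≱ (notLong u≤1) (≤-trans (n≤1+n q) (≤-reflexive (sym v≡)))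
  ... | inj₂ (inj₂ (consecutive v≡ _))  = <⇒≱ far (≤-trans (≤-reflexive v≡) (n≤1+n _))
  ... | inj₂ (inj₂ (long u≤1 v≡ _))     = <-irrefl v≡ (notLong u≤1)

  classify : ∀ {x y z} → x < y → y < z → z < N → ¬ Forbidden x y z →
             FarPair x z ⊎ FarPair x y ⊎ FarPair y z ⊎ (y ≤ 1 × q ≤ z)
  classify {x} {y} {z} x<y y<z z<N ¬f with 2 + x <? z | x ≤? 1 | z <? q
  ... | no z≯x+2 | _ | _ = ⊥-elim (¬f (consecutive y≡x+1 z≡y+1))
    where
      z≤x+2 : z ≤ 2 + x
      z≤x+2 = ≤-pred (≰⇒> z≯x+2)
      y≡x+1 : y ≡ suc x
      y≡x+1 = ≤-antisym (≤-pred (≤-trans y<z z≤x+2)) x<y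
      z≡y+1 : z ≡ suc y
      z≡y+1 = ≤-antisym (≤-trans z≤x+2 (s≤s x<y)) y<z
  ... | yes far | no x≰1 | _       = inj₁ (far , ⊥-elim ∘ x≰1)
  ... | yes far | yes _  | yes z<q = inj₁ (far , λ _ → z<q)
  ... | yes _   | yes x≤1 | no z≮q = nearTop (≮⇒≥ z≮q)
    where
      nearTop : q ≤ z → FarPair x z ⊎ FarPair x y ⊎ FarPair y z ⊎ (y ≤ 1 × q ≤ z)
      nearTop q≤z with y ≤? 1 | 2 + y <? z | y <? q
      ... | yes y≤1 | _ | _            = inj₂ (inj₂ (inj₂ (y≤1 , q≤z)))
      ... | no y≰1  | yes far | _      = inj₂ (inj₂ (inj₁ (far , ⊥-elim ∘ y≰1)))
      ... | no _    | no z≯y+2 | yes y<q = inj₂ (inj₁ (far , λ _ → y<q))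
        where
          6+m≤y : 6 + m ≤ y
          6+m≤y = ≤-pred (≤-pred (≤-trans q≤z (≤-pred (≰⇒> z≯y+2))))
          far : 2 + x < y
          far = ≤-trans (s≤s (s≤s (s≤s x≤1))) (≤-trans (m≤m+n 4 (2 + m)) 6+m≤y)
      ... | no _    | no _ | no y≮q = ⊥-elim (¬f (long x≤1 y≡q z≡q+1))
        where
          y≡q : y ≡ q
          y≡q = ≤-antisym (≤-pred (≤-trans y<z (≤-pred z<N))) (≮⇒≥ y≮q)
          z≡q+1 : z ≡ suc q
          z≡q+1 = ≤-antisym (≤-pred z<N) (≤-trans (s≤s (≮⇒≥ y≮q)) y<z)

  Forbidden-gap : ∀ {a b c g} → Forbidden a b c → b < g → g < c → ⊥
  Forbidden-gap f b<g g<c = <⇒≱ b<g (≤-pred (subst (_ <_) (Forbidden-top f) g<c))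

  ¬Line-across : ∀ {g a b p} → toℕ a < g → toℕ b < g → g < toℕ p → ¬ (Line p a b ⊎ Line a p b ⊎ Line a b p)
  ¬Line-across a<g _   g<p (inj₁ f)        = <-asym (<-trans a<g g<p) (proj₁ (Forbidden-increasing f))
  ¬Line-across _   b<g g<p (inj₂ (inj₁ f)) = <-asym (<-trans b<g g<p) (proj₂ (Forbidden-increasing f))
  ¬Line-across _   b<g g<p (inj₂ (inj₂ f)) = Forbidden-gap f b<g g<p

  ¬Sym-across : ∀ {g u v p} → toℕ u < g → toℕ v < g → g < toℕ p → ¬ Sym u v p
  ¬Sym-across {u = u} {v} u<g v<g g<p s with Finₚ.<-cmp u v
  ... | tri< u<v _ _ = ¬Line-across u<g v<g g<p (Sym-cases s u<v)
  ... | tri≈ _ u≡v _ = Sym-distinct s u≡v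
  ... | tri> _ _ v<u = ¬Line-across v<g u<g g<p (Sym-cases (Sym-swap s) v<u)

  prefix-closedIn : ∀ {W g} → g ∉ W → ClosedIn W (W ∩ below (toℕ g))
  prefix-closedIn {W} {g} g∉W = p∩q⊆p W (below (toℕ g)) , close
    where
      close : ∀ {u v p} → u ∈ W ∩ below (toℕ g) → v ∈ W ∩ below (toℕ g) → p ∈ W → Sym u v p →
              p ∈ W ∩ below (toℕ g)
      close {u} {v} {p} u∈ v∈ p∈W s = x∈p∩q⁺ (p∈W , ∈-below⁺ p (≰⇒> g≰p))
        where
          g≰p : ¬ toℕ g ≤ toℕ p
          g≰p g≤p with m≤n⇒m<n∨m≡n g≤p
          ... | inj₁ g<p =
            ¬Sym-across (∈-below⁻ u (proj₂ (x∈p∩q⁻ W _ u∈))) (∈-below⁻ v (proj₂ (x∈p∩q⁻ W _ v∈))) g<p s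
          ... | inj₂ g≡p = g∉W (subst (_∈ W) (toℕ-injective (sym g≡p)) p∈W)

  module _ {W : Subset N} where
    open Restriction W

    gap-separable : ∀ {g} → g ∉ W → 2 ≤ toℕ g → toℕ g ≤ q → AllSeparable
    gap-separable {g} g∉W 2≤g g≤q {x} {y} {z} x<y y<z x∈W y∈W z∈W ¬f with classify x<y y<z (toℕ<n z) ¬f
    ... | inj₁ far =
      _ , inj₂ (inj₁ (pair-separates x∈W z∈W (farPair⇒noThird far) (Finₚ.<⇒≢ x<y ∘ sym) (Finₚ.<⇒≢ y<z)))
    ... | inj₂ (inj₁ far) =
      _ , inj₁ (pair-separates x∈W y∈W (farPair⇒noThird far)
                               (Finₚ.<⇒≢ (<-trans x<y y<z) ∘ sym) (Finₚ.<⇒≢ y<z ∘ sym))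
    ... | inj₂ (inj₂ (inj₁ far)) =
      _ , inj₂ (inj₂ (pair-separates y∈W z∈W (farPair⇒noThird far) (Finₚ.<⇒≢ x<y) (Finₚ.<⇒≢ (<-trans x<y y<z))))
    ... | inj₂ (inj₂ (inj₂ (y≤1 , q≤z))) =
      _ , inj₁ ( prefix-closedIn g∉W , x∈p∩q⁺ (x∈W , ∈-below⁺ x (<-trans x<y y<g))
               , x∈p∩q⁺ (y∈W , ∈-below⁺ y y<g) , z∉)
      where
        y<g : toℕ y < toℕ g
        y<g = ≤-trans (s≤s y≤1) 2≤g
        z∉ : z ∉ W ∩ below (toℕ g)
        z∉ z∈ = <⇒≱ (∈-below⁻ z (proj₂ (x∈p∩q⁻ W _ z∈))) (≤-trans g≤q q≤z)

  gap-exists : ∀ {W} → ∣ W ∣ ≤ m → ∃ λ g → g ∉ W × 2 ≤ toℕ g × toℕ g ≤ q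
  gap-exists {W} ∣W∣≤m with Finₚ.any? (λ g → ¬? (g ∈? W) ×-dec (2 ≤? toℕ g) ×-dec (toℕ g ≤? q))
  ... | yes gap = gap
  ... | no noGap = ⊥-elim (<⇒≱ (s≤s (s≤s (s≤s (m≤n+m m 6)))) (≤-trans counting (≤-reflexive (+-comm m 2))))
    where
      covered : below {N} (suc q) ⊆ W ∪ below 2
      covered {i} i∈ with i ∈? W | 2 ≤? toℕ i
      ... | yes i∈W | _ = x∈p∪q⁺ (inj₁ i∈W)
      ... | no i∉W | yes 2≤i = ⊥-elim (noGap (i , i∉W , 2≤i , ≤-pred (∈-below⁻ i i∈)))
      ... | no _   | no i≱2 = x∈p∪q⁺ (inj₂ (∈-below⁺ i (≰⇒> i≱2)))
      counting : suc q ≤ m + 2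
      counting = begin
        suc q                   ≡⟨ sym (∣below∣ {N} (suc q) (n≤1+n _)) ⟩
        ∣ below {N} (suc q) ∣   ≤⟨ p⊆q⇒∣p∣≤∣q∣ covered ⟩
        ∣ W ∪ below 2 ∣         ≤⟨ ∣p∪q∣≤∣p∣+∣q∣ W (below 2) ⟩
        ∣ W ∣ + ∣ below {N} 2 ∣ ≤⟨ +-mono-≤ ∣W∣≤m (≤-reflexive (∣below∣ {N} 2 (s≤s (s≤s z≤n)))) ⟩
        m + 2                   ∎
        where open ≤-Reasoning

  small-restriction-TBP₂ : ∀ {W} → Nonempty W → ∣ W ∣ ≤ m → TBP₂ (restrict K W)
  small-restriction-TBP₂ {W} ne ∣W∣≤m =
    let g , g∉W , 2≤g , g≤q = gap-exists ∣W∣≤m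
    in Restriction.restriction-TBP₂ W ne (gap-separable g∉W 2≤g g≤q)

theorem6p23 : ¬ (Σ ℕ λ m → 1 ≤ m ×
    (∀ n (K : Pre n) → IsSC K → ¬ TBP₂ K →
    Σ (Subset n) λ W → W ⊆ V K × Nonempty W × ∣ W ∣ ≤ m × ¬ TBP₂ (restrict K W)))
theorem6p23 (m , _ , smallWitness) =
  let open Construction m
      W , _ , ne , ∣W∣≤m , ¬TBP₂ = smallWitness N K K-isSC K-¬TBP₂
  in ¬TBP₂ (small-restriction-TBP₂ ne ∣W∣≤m)
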